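{- Let $G=(V_1,V_2,E)$ be a game structure, $p\colon V\to\{0,\dots,d\}$ a priority function ($d$ even) and $\lambda\in\mathbb{N}_0$. Then: (1) $\mathsf{DirFixPR}(\lambda,p)\subseteq\mathsf{FixPR}(\lambda,p)$, $\mathsf{DirFixWP}(\lambda,p)\subseteq\mathsf{FixWP}(\lambda,p)$, $\mathsf{DirBndPR}(p)\subseteq\mathsf{BndPR}(p)$ and $\mathsf{DirBndWP}(p)\subseteq\mathsf{BndWP}(p)$. (2) For $\mathsf{X}\in\{\mathsf{PR},\mathsf{WP}\}$: $\mathsf{FixX}(\lambda,p)\subseteq\mathsf{BndX}(p)$ and $\mathsf{DirFixX}(\lambda,p)\subseteq\mathsf{DirBndX}(p)$. (3) For all $\lambda'>\lambda$ and $\mathsf{X}\in\{\mathsf{PR},\mathsf{WP}\}$: $\mathsf{FixX}(\lambda,p)\subseteq\mathsf{FixX}(\lambda',p)$ and $\mathsf{DirFixX}(\lambda,p)\subseteq\mathsf{DirFixX}(\lambda',p)$. (4) $\mathsf{FixWP}(\lambda,p)\subseteq\mathsf{FixPR}(\lambda,p)$ and $\mathsf{DirFixWP}(\lambda,p)\subseteq\mathsf{DirFixPR}(\lambda,p)$. (5) If $d\ge 2$: $\mathsf{FixPR}(\lambda,p)\subseteq\mathsf{FixWP}(\tfrac d2\cdot\lambda,p)$ and $\mathsf{DirFixPR}(\lambda,p)\subseteq\mathsf{DirFixWP}(\tfrac d2\cdot\lambda,p)$. (6) $\mathsf{BndPR}(p)=\mathsf{BndWP}(p)$ and $\mathsf{DirBndPR}(p)=\mathsf{DirBndWP}(p)$.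 (7) $\mathsf{BndWP}(p)\subseteq\mathsf{Parity}(p)$ and $\mathsf{DirBndWP}(p)\subseteq\mathsf{Parity}(p)$.
   Context: A game structure is $G=(V_1,V_2,E)$ with $V=V_1\cup V_2$ finite (disjoint union), $E\subseteq V\times V$, every vertex having an outgoing edge. A play is an infinite sequence $\pi=v_0v_1\dots$ with $(v_k,v_{k+1})\in E$; $\pi[k]=v_k$, $\pi[k,\infty]=v_kv_{k+1}\dots$. $\mathbb{N}_0$ denotes the positive integers. A priority function is $p\colon V\to\{0,\dots,d\}$ with $d$ even. For priorities, $c\preceq c'$ iff $c$ is even and $c\le c'$. For $\lambda\in\mathbb{N}_0$: $\mathsf{DirFixPR}(\lambda,p)=\{\pi\mid\forall j\ge0\ \exists l\in\{0,\dots,\lambda-1\}:\ p(\pi[j+l])\preceq p(\pi[j])\}$; $\mathsf{DirFixWP}(\lambda,p)=\{\pi\mid\forall j\ge0\ \exists l\in\{0,\dots,\lambda-1\}\ \forall k\in\{0,\dots,l\}:\ p(\pi[j+l])\preceq p(\pi[j+k])\}$; and for $\mathsf{X}\in\{\mathsf{PR},\mathsf{WP}\}$: $\mathsf{FixX}(\lambda,p)=\{\pi\mid\exists i\ge0:\ \pi[i,\infty]\in\mathsf{DirFixX}(\lambda,p)\}$, $\mathsf{DirBndX}(p)=\{\pi\mid\exists\lambda\in\mathbb{N}_0:\ \pi\in\mathsf{DirFixX}(\lambda,p)\}$, $\mathsf{BndX}(p)=\{\pi\mid\exists i\ge0:\ \pi[i,\infty]\in\mathsf{DirBndX}(p)\}$.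 Finally $\mathsf{Parity}(p)$ is the set of plays $\pi$ such that the minimum of $p(v)$ over the vertices $v$ occurring infinitely often in $\pi$ is even. -}

module Defs where

open import Data.Nat using (ℕ; zero; suc; _+_; _*_; _≤_; _<_)
open import Data.Nat.Divisibility using (_∣_)
open import Data.Fin using (Fin)
open import Data.Bool using (Bool)
open import Data.Product using (Σ; ∃; _×_; _,_)
open import Relation.Binary.PropositionalEquality using (_≡_)

-- V is represented as Fin size; the partition into V₁ / V₂ is given by
-- the owner function (true = V₁, false = V₂), which makes the union
-- disjoint and exhaustive.
record GameStructure : Set₁ where
  field
    size   : ℕ
    owner  : Fin size → Bool
    E      : Fin size → Fin size → Set
    total  : ∀ v → ∃ λ w → E v w

open GameStructure public

Vertex : GameStructure → Set
Vertex G = Fin (size G)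

Seq : GameStructure → Set
Seq G = ℕ → Vertex G

IsPlay : (G : GameStructure) → Seq G → Set
IsPlay G π = ∀ k → E G (π k) (π (suc k))

suffix : {G : GameStructure} → ℕ → Seq G → Seq G
suffix i π = λ k → π (i + k)

PlaySet : GameStructure → Set₁
PlaySet G = Seq G → Set

Incl : (G : GameStructure) → PlaySet G → PlaySet G → Set
Incl G A B = ∀ (π : Seq G) → IsPlay G π → A π → B π

syntax Incl G A B = A ⊆[ G ] B

Eql : (G : GameStructure) → PlaySet G → PlaySet G → Set
Eql G A B = (A ⊆[ G ] B) × (B ⊆[ G ] A)

syntax Eql G A B = A ≐[ G ] B

Even : ℕ → Set
Even c = 2 ∣ c

_≼_ : ℕ → ℕ → Set
c ≼ c' = Even c × c ≤ c'

data Cond : Set where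
  PR WP : Cond

DirFix : (G : GameStructure) → Cond → ℕ → (Vertex G → ℕ) → PlaySet G
DirFix G PR lam p π =
  ∀ j → ∃ λ l → l < lam × p (π (j + l)) ≼ p (π j)
DirFix G WP lam p π =
  ∀ j → ∃ λ l → l < lam × (∀ k → k ≤ l → p (π (j + l)) ≼ p (π (j + k)))

Fix : (G : GameStructure) → Cond → ℕ → (Vertex G → ℕ) → PlaySet G
Fix G X lam p π = ∃ λ i → DirFix G X lam p (suffix {G} i π)

DirBnd : (G : GameStructure) → Cond → (Vertex G → ℕ) → PlaySet G
DirBnd G X p π = ∃ λ lam → 1 ≤ lam × DirFix G X lam p π

Bnd : (G : GameStructure) → Cond → (Vertex G → ℕ) → PlaySet G
Bnd G X p π = ∃ λ i → DirBnd G X p (suffix {G} i π)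

InfOften : (G : GameStructure) → Seq G → Vertex G → Set
InfOften G π v = ∀ i → ∃ λ j → i ≤ j × π j ≡ v

Parity : (G : GameStructure) → (Vertex G → ℕ) → PlaySet G
Parity G p π =
  ∃ λ (v : Vertex G) → InfOften G π v × Even (p v)
    × (∀ (w : Vertex G) → InfOften G π w → p v ≤ p w)

-- A PR-bounded sequence is WP-bounded because, starting from any position,
-- one can chase odd prefix minima: an odd minimum is answered by a strictly
-- smaller even priority, so with priorities in {0,…,2h} after at most h such
-- answers (each within λ steps) the prefix minimum is even, and that position
-- answers every priority seen since the start.  For the parity condition, by
-- finiteness some suffix only visits recurrent vertices; the least recurrent
-- priority is answered by an even recurrent priority not above it, so it is even.
module Submission where

open import Defs
open import Level using (0ℓ)
open import Function using (_∘_)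
open import Data.Nat using (ℕ; zero; suc; _+_; _*_; _⊔_; _≤_; _<_; z≤n; s≤s; _≤?_)
open import Data.Nat.Properties
open import Data.Nat.DivMod using (_/_; m*n/n≡m)
open import Data.Nat.Divisibility using (divides; _∣?_; _∣0)
open import Data.Fin using (Fin)
import Data.Fin as Fin
open import Data.Product using (_×_; _,_; ∃; map₁; map₂)
open import Data.Sum using (inj₁; inj₂)
open import Data.Empty using (⊥-elim)
open import Relation.Nullary using (¬_; yes; no)
open import Relation.Unary using (_⊆′_)
open import Relation.Binary.PropositionalEquality using (_≡_; refl; sym; subst; cong)
open import Axiom.ExcludedMiddle using (ExcludedMiddle)
open import Axiom.DoubleNegationElimination using (em⇒dne)

private
  variable
    G : GameStructure
    X : Cond
    h i m lam lam' x y : ℕ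
    q : ℕ → ℕ
    R S : ℕ → ℕ → Set

even<odd : Even x → ¬ Even y → x ≤ y → x < y
even<odd even odd x≤y = ≤∧≢⇒< x≤y λ { refl → odd even }

even<2[1+h]⇒≤2h : Even x → x < 2 * suc h → x ≤ 2 * h
even<2[1+h]⇒≤2h {h = h} (divides k refl) k*2<2[1+h] =
  subst (k * 2 ≤_) (*-comm h 2)
    (*-monoˡ-≤ 2 (≤-pred (*-cancelʳ-< 2 k (suc h)
      (subst (k * 2 <_) (*-comm 2 (suc h)) k*2<2[1+h]))))

AnsweredWithin : ℕ → (ℕ → ℕ → Set) → Set
AnsweredWithin lam R = ∀ j → ∃ λ l → l < lam × R j l

PRAnswer : (ℕ → ℕ) → ℕ → ℕ → Set
PRAnswer q j l = q (j + l) ≼ q j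

WPAnswer : (ℕ → ℕ) → ℕ → ℕ → Set
WPAnswer q j l = ∀ k → k ≤ l → q (j + l) ≼ q (j + k)

AnsweredWithin-mono : lam ≤ lam' → AnsweredWithin lam R → AnsweredWithin lam' R
AnsweredWithin-mono lam≤lam' answered j = map₂ (map₁ (λ l< → <-≤-trans l< lam≤lam')) (answered j)

AnsweredWithin-map : (∀ {j l} → R j l → S j l) → AnsweredWithin lam R → AnsweredWithin lam S
AnsweredWithin-map R⇒S answered j = map₂ (map₂ R⇒S) (answered j)

WPAnswer⇒PRAnswer : ∀ {j l} → WPAnswer q j l → PRAnswer q j l
WPAnswer⇒PRAnswer {q = q} {j} {l} answer = subst (λ n → q (j + l) ≼ q n) (+-identityʳ j) (answer 0 z≤n)

argmin-upTo : (f : ℕ → ℕ) → ∀ a → ∃ λ b → b ≤ a × (∀ k → k ≤ a → f b ≤ f k)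
argmin-upTo f zero = 0 , z≤n , λ { .0 z≤n → ≤-refl }
argmin-upTo f (suc a) with argmin-upTo f a
... | b , b≤a , minimal with f b ≤? f (suc a)
... | yes fb≤ = b , m≤n⇒m≤1+n b≤a , λ k k≤1+a → case k k≤1+a
  where
  case : ∀ k → k ≤ suc a → f b ≤ f k
  case k k≤1+a with m≤n⇒m<n∨m≡n k≤1+a
  ... | inj₁ k<1+a = minimal k (≤-pred k<1+a)
  ... | inj₂ refl = fb≤
... | no fb≰ = suc a , ≤-refl , λ k k≤1+a → case k k≤1+a
  where
  case : ∀ k → k ≤ suc a → f (suc a) ≤ f k
  case k k≤1+a with m≤n⇒m<n∨m≡n k≤1+a
  ... | inj₁ k<1+a = ≤-trans (≰⇒≥ fb≰) (minimal k (≤-pred k<1+a))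
  ... | inj₂ refl = ≤-refl

module _ (answered : AnsweredWithin (suc m) (PRAnswer q)) (j : ℕ) where

  WPAnswerBy : ℕ → Set
  WPAnswerBy n = ∃ λ l → l ≤ n × WPAnswer q j l

  mutual
    wpAnswerBy : ∀ h a → q (j + a) ≤ 2 * h → WPAnswerBy (a + h * m)
    wpAnswerBy h a bound with argmin-upTo (λ k → q (j + k)) a
    ... | b , b≤a , minimal with 2 ∣? q (j + b)
    ... | yes even = b , ≤-trans b≤a (m≤m+n a (h * m)) , λ k k≤b → even , minimal k (≤-trans k≤b b≤a)
    ... | no odd = map₂ (map₁ (λ l≤ → ≤-trans l≤ (+-monoˡ-≤ (h * m) b≤a)))
                        (oddAnswerBy h b odd (≤-trans (minimal a ≤-refl) bound))

    -- An odd priority is answered by a strictly smaller even one, which lowers the budget h.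
    oddAnswerBy : ∀ h b → ¬ Even (q (j + b)) → q (j + b) ≤ 2 * h → WPAnswerBy (b + h * m)
    oddAnswerBy zero b odd bound = ⊥-elim (odd (subst Even (sym (n≤0⇒n≡0 bound)) (2 ∣0)))
    oddAnswerBy (suc h) b odd bound with answered (j + b)
    ... | l , l<1+m , even , below rewrite +-assoc j b l =
      map₂ (map₁ (λ l'≤ → ≤-trans l'≤ (≤-trans (+-monoˡ-≤ (h * m) (+-monoʳ-≤ b (≤-pred l<1+m)))
                                                (≤-reflexive (+-assoc b m (h * m))))))
           (wpAnswerBy h (b + l) (even<2[1+h]⇒≤2h even (<-≤-trans (even<odd even odd below) bound)))

PRAnswered⇒WPAnswered : ∀ h → (∀ k → q k ≤ 2 * h) →
  AnsweredWithin (suc m) (PRAnswer q) → AnsweredWithin (suc (h * m)) (WPAnswer q)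
PRAnswered⇒WPAnswered h bounded answered j =
  map₂ (map₁ s≤s) (wpAnswerBy answered j h 0 (bounded (j + 0)))

AnsweredFrom : ℕ → (ℕ → ℕ) → Set
AnsweredFrom i q = ∀ j → i ≤ j → ∃ (PRAnswer q j)

suffix-answered⇒AnsweredFrom : AnsweredWithin lam (PRAnswer (q ∘ (i +_))) → AnsweredFrom i q
suffix-answered⇒AnsweredFrom {q = q} {i = i} answered j i≤j with m≤n⇒∃[o]m+o≡n i≤j
... | r , refl with answered r
... | l , _ , answer = l , subst (λ n → q n ≼ q (i + r)) (sym (+-assoc i r l)) answer

classical-minimum : ExcludedMiddle 0ℓ → {A : Set} (P : A → Set) (f : A → ℕ) {a : A} → P a →
                    ∃ λ b → P b × (∀ c → P c → f b ≤ f c)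
classical-minimum em {A} P f {a} pa = descend (f a) a ≤-refl pa
  where
  descend : ∀ n a → f a ≤ n → P a → ∃ λ b → P b × (∀ c → P c → f b ≤ f c)
  descend n a fa≤n pa with em {∃ λ c → P c × f c < f a}
  ... | no ∄smaller = a , pa , λ c pc → ≮⇒≥ (λ fc<fa → ∄smaller (c , pc , fc<fa))
  descend zero a fa≤0 pa | yes (c , pc , fc<fa) = ⊥-elim (n≮0 (<-≤-trans fc<fa fa≤0))
  descend (suc n) a fa≤1+n pa | yes (c , pc , fc<fa) = descend n c (≤-pred (<-≤-trans fc<fa fa≤1+n)) pc

uniform-bound : ∀ {n} (P : Fin n → ℕ → Set) → (∀ x → ∃ λ b → ∀ j → b ≤ j → P x j) →
                ∃ λ N → ∀ x j → N ≤ j → P x j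
uniform-bound {zero} P bounds = 0 , λ ()
uniform-bound {suc n} P bounds with bounds Fin.zero | uniform-bound (P ∘ Fin.suc) (bounds ∘ Fin.suc)
... | b , hb | N , hN = b ⊔ N , λ
  { Fin.zero j b⊔N≤j → hb j (≤-trans (m≤m⊔n b N) b⊔N≤j)
  ; (Fin.suc x) j b⊔N≤j → hN x j (≤-trans (m≤n⊔m b N) b⊔N≤j) }

module Plays (G : GameStructure) (p : Vertex G → ℕ) where

  Eventually : PlaySet G → PlaySet G
  Eventually A π = ∃ λ i → A (suffix {G} i π)

  eventually-now : {A : PlaySet G} → A ⊆′ Eventually A
  eventually-now _ a = 0 , a

  Eventually-map : {A B : PlaySet G} → A ⊆′ B → Eventually A ⊆′ Eventually B
  Eventually-map A⊆B π (i , a) = i , A⊆B (suffix {G} i π) a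

  ⊆′⇒⊆[] : {A B : PlaySet G} → A ⊆′ B → A ⊆[ G ] B
  ⊆′⇒⊆[] A⊆B π _ = A⊆B π

  ⊆′⇒Eventually-⊆[]-× : {A B : PlaySet G} → A ⊆′ B → (Eventually A ⊆[ G ] Eventually B) × (A ⊆[ G ] B)
  ⊆′⇒Eventually-⊆[]-× A⊆B = ⊆′⇒⊆[] (Eventually-map A⊆B) , ⊆′⇒⊆[] A⊆B

  DirFix⊆DirBnd : 1 ≤ lam → DirFix G X lam p ⊆′ DirBnd G X p
  DirFix⊆DirBnd {lam} 1≤lam _ df = lam , 1≤lam , df

  DirFix-mono : ∀ X → lam ≤ lam' → DirFix G X lam p ⊆′ DirFix G X lam' p
  DirFix-mono PR lam≤lam' _ = AnsweredWithin-mono lam≤lam'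
  DirFix-mono WP lam≤lam' _ = AnsweredWithin-mono lam≤lam'

  DirFixWP⊆DirFixPR : DirFix G WP lam p ⊆′ DirFix G PR lam p
  DirFixWP⊆DirFixPR π = AnsweredWithin-map (WPAnswer⇒PRAnswer {q = p ∘ π})

  DirFixPR⊆DirFixWP : ∀ h → (∀ v → p v ≤ 2 * h) → DirFix G PR (suc m) p ⊆′ DirFix G WP (suc (h * m)) p
  DirFixPR⊆DirFixWP h bounded π = PRAnswered⇒WPAnswered h (bounded ∘ π)

  DirBndWP⊆DirBndPR : DirBnd G WP p ⊆′ DirBnd G PR p
  DirBndWP⊆DirBndPR π = map₂ (map₂ (DirFixWP⊆DirFixPR π))

  DirBndPR⊆DirBndWP : ∀ h → (∀ v → p v ≤ 2 * h) → DirBnd G PR p ⊆′ DirBnd G WP p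
  DirBndPR⊆DirBndWP h bounded π (suc m , _ , df) = suc (h * m) , s≤s z≤n , DirFixPR⊆DirFixWP h bounded π df

  module _ (em : ExcludedMiddle 0ℓ) where

    recurrence-bound : (π : Seq G) (w : Vertex G) → ∃ λ b → ∀ j → b ≤ j → π j ≡ w → InfOften G π w
    recurrence-bound π w = em⇒dne em λ ∄bound → ∄bound (0 , λ _ _ _ → recurrent ∄bound)
      where
      recurrent : ¬ (∃ λ b → ∀ j → b ≤ j → π j ≡ w → InfOften G π w) → InfOften G π w
      recurrent ∄bound i = em⇒dne em λ ∄visit →
        ∄bound (i , λ j i≤j πj≡w → ⊥-elim (∄visit (j , i≤j , πj≡w)))

    eventually-recurrent : (π : Seq G) → ∃ λ N → ∀ j → N ≤ j → InfOften G π (π j)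
    eventually-recurrent π =
      map₂ (λ bound j N≤j → bound (π j) j N≤j refl) (uniform-bound _ (recurrence-bound π))

    AnsweredFrom⇒Parity : (π : Seq G) → AnsweredFrom i (p ∘ π) → Parity G p π
    AnsweredFrom⇒Parity {i} π answered with eventually-recurrent π
    ... | N , recurrent with classical-minimum em (InfOften G π) p (recurrent N ≤-refl)
    ... | v , v-recurrent , minimal with v-recurrent (i + N)
    ... | j , i+N≤j , refl with answered j (≤-trans (m≤m+n i N) i+N≤j)
    ... | l , even , below =
      π j , v-recurrent , subst Even (≤-antisym below (minimal _ (recurrent (j + l) N≤j+l))) even , minimal
      where
      N≤j+l : N ≤ j + l
      N≤j+l = ≤-trans (m≤n+m N i) (≤-trans i+N≤j (m≤m+n j l))

    BndPR⊆Parity : Bnd G PR p ⊆′ Parity G p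
    BndPR⊆Parity π (i , _ , _ , df) = AnsweredFrom⇒Parity π (suffix-answered⇒AnsweredFrom {q = p ∘ π} df)

    BndWP⊆Parity : Bnd G WP p ⊆′ Parity G p
    BndWP⊆Parity π = BndPR⊆Parity π ∘ Eventually-map DirBndWP⊆DirBndPR π

1+h*m≤h*[1+m] : 1 ≤ h → suc (h * m) ≤ h * suc m
1+h*m≤h*[1+m] {h} {m} 1≤h = subst (suc (h * m) ≤_) (sym (*-suc h m)) (+-monoˡ-≤ (h * m) 1≤h)

proposition1 : (G : GameStructure) (d : ℕ) → Even d →
    (p : Vertex G → ℕ) → (∀ v → p v ≤ d) →
    (lam : ℕ) → 1 ≤ lam →
    ((∀ X → DirFix G X lam p ⊆[ G ] Fix G X lam p)
      × (∀ X → DirBnd G X p ⊆[ G ] Bnd G X p))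
    × (∀ X → (Fix G X lam p ⊆[ G ] Bnd G X p) × (DirFix G X lam p ⊆[ G ] DirBnd G X p))
    × (∀ lam' → lam < lam' → ∀ X →
        (Fix G X lam p ⊆[ G ] Fix G X lam' p) × (DirFix G X lam p ⊆[ G ] DirFix G X lam' p))
    × ((Fix G WP lam p ⊆[ G ] Fix G PR lam p) × (DirFix G WP lam p ⊆[ G ] DirFix G PR lam p))
    × (2 ≤ d →
        (Fix G PR lam p ⊆[ G ] Fix G WP ((d / 2) * lam) p)
          × (DirFix G PR lam p ⊆[ G ] DirFix G WP ((d / 2) * lam) p))
    × ((Bnd G PR p ≐[ G ] Bnd G WP p) × (DirBnd G PR p ≐[ G ] DirBnd G WP p))
    × (ExcludedMiddle 0ℓ →
        (Bnd G WP p ⊆[ G ] Parity G p) × (DirBnd G WP p ⊆[ G ] Parity G p))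
proposition1 G .(h * 2) (divides h refl) p p≤d (suc m) 1≤lam =
  ((λ X → ⊆′⇒⊆[] eventually-now) , (λ X → ⊆′⇒⊆[] eventually-now))
  , (λ X → ⊆′⇒Eventually-⊆[]-× (DirFix⊆DirBnd 1≤lam))
  , (λ lam' lam<lam' X → ⊆′⇒Eventually-⊆[]-× (DirFix-mono X (<⇒≤ lam<lam')))
  , ⊆′⇒Eventually-⊆[]-× DirFixWP⊆DirFixPR
  , (λ 2≤d → ⊆′⇒Eventually-⊆[]-× λ π → DirFix-mono WP (1+h*m≤d/2*[1+m] 2≤d) π ∘ DirFixPR⊆DirFixWP h p≤2h π)
  , ( (⊆′⇒⊆[] (Eventually-map (DirBndPR⊆DirBndWP h p≤2h)) , ⊆′⇒⊆[] (Eventually-map DirBndWP⊆DirBndPR))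
    , (⊆′⇒⊆[] (DirBndPR⊆DirBndWP h p≤2h) , ⊆′⇒⊆[] DirBndWP⊆DirBndPR))
  , (λ em → ⊆′⇒⊆[] (BndWP⊆Parity em) , ⊆′⇒⊆[] λ π → BndWP⊆Parity em π ∘ (0 ,_))
  where
  open Plays G p
  p≤2h : ∀ v → p v ≤ 2 * h
  p≤2h v = subst (p v ≤_) (*-comm h 2) (p≤d v)
  1+h*m≤d/2*[1+m] : 2 ≤ h * 2 → suc (h * m) ≤ (h * 2 / 2) * suc m
  1+h*m≤d/2*[1+m] 2≤d = subst (suc (h * m) ≤_) (cong (_* suc m) (sym (m*n/n≡m h 2)))
                                (1+h*m≤h*[1+m] (*-cancelʳ-≤ 1 h 2 2≤d))
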